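{- Let $k\ge1$. Set $a_k(0)=1$ and, for $n\ge1$, $a_k(n)=\mathrm{mp}_{213}(n,k)$. Then $\mathrm{mp}_{213}(n,k)=\mathrm{mp}_{132}(n,k)$ for all $n\ge1$, and for all $n\ge0$ \[ a_k(n+1) = \sum_{\substack{0\le j\le n\\ k\mid j}} a_k(j)\,a_k(n-j). \]
   Context: A permutation $\pi$ of $[n]$ is mod-$k$-alternating if $\pi(i)\equiv i\pmod k$ for all $i$. A permutation contains a pattern $\sigma$ if some subsequence of its one-line notation is order-isomorphic to $\sigma$, and avoids it otherwise. $\mathrm{mp}_\sigma(n,k)$ is the number of mod-$k$-alternating permutations of $[n]$ avoiding $\sigma$. -}

module Defs where

open import Data.Nat using (ℕ; zero; suc; _+_; _*_; _∸_; _%_; NonZero)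
open import Data.Nat.Divisibility using (_∣_; _∣?_)
open import Data.Fin using (Fin; toℕ; _<_; _<?_)
import Data.Fin.Properties as FinP
open import Data.Vec using (Vec; []; _∷_; lookup)
open import Data.List using (List; []; _∷_; length; filter; map; concatMap; upTo)
open import Data.Nat.ListAction using (sum)
open import Data.Product using (Σ; ∃; _×_; _,_)
open import Relation.Binary.PropositionalEquality using (_≡_)
open import Relation.Nullary using (Dec; yes; no; ¬_; ¬?)
open import Relation.Nullary.Decidable using (_×-dec_; _→-dec_)
open import Data.Nat.Properties using () renaming (_≟_ to _≟ℕ_)
open import Function using (_⇔_)
open import Data.Product using (proj₁)

allWords : (m n : ℕ) → List (Vec (Fin n) m)
allWords zero    n = [] ∷ []
allWords (suc m) n =
  concatMap (λ w → map (λ x → x ∷ w) (Data.List.allFin n)) (allWords m n)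
  where import Data.List

-- A word of length n over Fin n is a permutation of [n] iff it is injective.
IsPerm : ∀ {n} → Vec (Fin n) n → Set
IsPerm {n} w = ∀ (i j : Fin n) → lookup w i ≡ lookup w j → i ≡ j

isPerm? : ∀ {n} (w : Vec (Fin n) n) → Dec (IsPerm w)
isPerm? w = FinP.all? λ i → FinP.all? λ j →
  (lookup w i FinP.≟ lookup w j) →-dec (i FinP.≟ j)

-- mod-k-alternating: π(i) ≡ i (mod k) for all i.  (We use 0-based values
-- and positions; shifting both by one does not change the congruence.)
ModAlt : ∀ {n} (k : ℕ) .{{_ : NonZero k}} → Vec (Fin n) n → Set
ModAlt {n} k w = ∀ (i : Fin n) → toℕ (lookup w i) % k ≡ toℕ i % k

modAlt? : ∀ {n} (k : ℕ) .{{_ : NonZero k}} (w : Vec (Fin n) n) → Dec (ModAlt k w)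
modAlt? k w = FinP.all? λ i → (toℕ (lookup w i) % k) ≟ℕ (toℕ i % k)

-- A pattern of length 3 is a permutation of {0,1,2} given in one-line
-- notation, e.g. 213 is  1 ∷ 0 ∷ 2 ∷ [].
Pattern3 : Set
Pattern3 = Vec (Fin 3) 3

OrderIso : ∀ {n} → Vec (Fin n) n → Pattern3 → (Fin 3 → Fin n) → Set
OrderIso w σ p = ∀ (a b : Fin 3) →
  ((lookup w (p a) < lookup w (p b)) → (lookup σ a < lookup σ b)) ×
  ((lookup σ a < lookup σ b) → (lookup w (p a) < lookup w (p b)))

triple : ∀ {n} → Fin n → Fin n → Fin n → Fin 3 → Fin n
triple i j l Fin.zero = i
triple i j l (Fin.suc Fin.zero) = j
triple i j l (Fin.suc (Fin.suc Fin.zero)) = l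
  where import Data.Fin as Fin

Contains : ∀ {n} → Vec (Fin n) n → Pattern3 → Set
Contains {n} w σ = Σ (Fin n) λ i → Σ (Fin n) λ j → Σ (Fin n) λ l →
  (i < j) × (j < l) × OrderIso w σ (triple i j l)

contains? : ∀ {n} (w : Vec (Fin n) n) (σ : Pattern3) → Dec (Contains w σ)
contains? w σ = FinP.any? λ i → FinP.any? λ j → FinP.any? λ l →
  (i <? j) ×-dec ((j <? l) ×-dec
    FinP.all? (λ a → FinP.all? λ b →
      ((lookup w (triple i j l a) <? lookup w (triple i j l b)) →-dec
         (lookup σ a <? lookup σ b)) ×-dec
      ((lookup σ a <? lookup σ b) →-dec
         (lookup w (triple i j l a) <? lookup w (triple i j l b)))))

mp : Pattern3 → (n k : ℕ) .{{_ : NonZero k}} → ℕ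
mp σ n k = length (filter (λ w → isPerm? w ×-dec (modAlt? k w ×-dec ¬? (contains? w σ)))
                          (allWords n n))

p213 p132 : Pattern3
p213 = Fin.suc Fin.zero ∷ Fin.zero ∷ Fin.suc (Fin.suc Fin.zero) ∷ []
  where import Data.Fin as Fin
p132 = Fin.zero ∷ Fin.suc (Fin.suc Fin.zero) ∷ Fin.suc Fin.zero ∷ []
  where import Data.Fin as Fin

a : (k : ℕ) .{{_ : NonZero k}} → ℕ → ℕ
a k zero    = 1
a k (suc n) = mp p213 (suc n) k

convSum : (k : ℕ) .{{_ : NonZero k}} → ℕ → ℕ
convSum k n = sum (map (λ j → a k j * a k (n ∸ j))
                       (filter (λ j → k ∣? j) (upTo (suc n))))

-- A 213-avoiding permutation of [n+1] starting with v is v, then a 213-avoider of the values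
-- above v, then one of the values below v.  Tracking the residue offset t of the positions
-- (entry i ≡ t + i mod k), the mod-k condition forces v ≡ t and passes to both blocks, giving
--   c(n+1, t) = Σ_{v ≤ n, v ≡ t} c(n-v, 0) · c(v, t+1+n-v).
-- On lengths divisible by k the offset is irrelevant, which turns the case t = 0 into the
-- claimed convolution.  That irrelevance is a generating-function identity: B = 1 + z B₀ B,
-- with B₀ the part of B on multiples of k, makes (zᵗ B₀ᵗ ⋆ z^(k-1-t) B₀^(k-1-t)) independent
-- of t; it is proved by strong induction, simultaneously with the recurrence itself.
-- Reverse-complement maps 132-avoiders bijectively to 213-avoiders and preserves the mod-k
-- condition, so mp₂₁₃ = mp₁₃₂.

module Submission where

open import Defs

open import Data.Nat
open import Data.Nat.Properties
open import Data.Nat.DivMod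
open import Data.Nat.Divisibility using (_∣_; _∣?_; n∣m⇒m%n≡0; m%n≡0⇒n∣m)
open import Data.Nat.Induction using (<-rec)
open import Data.Nat.ListAction using (sum)
open import Data.Nat.ListAction.Properties using (sum-++)
open import Data.Bool using (if_then_else_)
open import Data.Empty using (⊥; ⊥-elim)
open import Data.Unit using (⊤; tt)
open import Data.Product using (∃-syntax; _×_; _,_; proj₁; proj₂)
open import Data.Sum using (_⊎_; inj₁; inj₂)
open import Function using (_∘_; mk⇔)
open import Relation.Nullary using (Dec; yes; no; ¬_; ¬?; does)
open import Relation.Nullary.Decidable using (_×-dec_; toWitness)
open import Relation.Binary.Definitions using (tri<; tri≈; tri>)
open import Relation.Unary using (Decidable)
open import Relation.Binary.PropositionalEquality

open import Data.Fin as Fin using (Fin; toℕ; fromℕ<; opposite)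
import Data.Fin.Properties as Fin
open import Data.Fin.Patterns using (0F; 1F; 2F)
open import Data.Vec as Vec using (Vec; []; _∷_; lookup; tabulate)
import Data.Vec.Properties as Vec
open import Data.List as List
  using (List; []; _∷_; _++_; length; map; filter; concatMap; upTo; allFin; takeWhile; dropWhile)
open import Data.List.Properties
  using ( length-map; length-++; length-filter; length-upTo; ∷-injectiveˡ; ∷-injectiveʳ; map-++; map-cong
        ; map-injective; filter-++; filter-≐; takeWhile++dropWhile; upTo-∷ʳ)
open import Data.List.Membership.Propositional using (_∈_; find; lose)
open import Data.List.Membership.Propositional.Properties
  using (∈-map⁺; ∈-map⁻; ∈-concatMap⁺; ∈-concatMap⁻; ∈-filter⁺; ∈-filter⁻; ∈-upTo⁺; ∈-upTo⁻
        ; ∈-allFin)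
open import Data.List.Membership.Propositional.Properties.WithK using (unique∧set⇒bag)
open import Data.List.Relation.Binary.BagAndSetEquality using (∼bag⇒↭)
open import Data.List.Relation.Binary.Permutation.Propositional.Properties using (↭-length)
open import Data.List.Relation.Unary.All as All using (All; []; _∷_)
import Data.List.Relation.Unary.All.Properties as All
open import Data.List.Relation.Unary.Any using (here; there)
open import Data.List.Relation.Unary.Unique.Propositional using (Unique; []; _∷_)
import Data.List.Relation.Unary.Unique.Propositional.Properties as Unique
open import Data.List.Relation.Binary.Sublist.Propositional using (_⊆_; []; _∷_; _∷ʳ_; ⊆-refl; ⊆-trans; minimum; from∈)
open import Data.List.Relation.Binary.Sublist.Propositional.Properties
  using (All-resp-⊆; takeWhile-⊆; dropWhile-⊆)
  renaming (map⁺ to ⊆-map⁺)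

private
  variable
    A B : Set

length-unique-≡ : {xs ys : List A} → Unique xs → Unique ys →
  (∀ {x} → x ∈ xs → x ∈ ys) → (∀ {x} → x ∈ ys → x ∈ xs) → length xs ≡ length ys
length-unique-≡ uxs uys to from = ↭-length (∼bag⇒↭ (unique∧set⇒bag uxs uys (mk⇔ to from)))

length-unique-bounded : ∀ {n} (xs : List ℕ) → Unique xs → All (_< n) xs → length xs ≤ n
length-unique-bounded {n} xs uxs bounded = begin
  length xs                          ≡⟨ length-unique-≡ uxs (Unique.filter⁺ (_∈? xs) (Unique.upTo⁺ n)) to from ⟩
  length (filter (_∈? xs) (upTo n))  ≤⟨ length-filter (_∈? xs) (upTo n) ⟩
  length (upTo n)                    ≡⟨ length-upTo n ⟩
  n                                  ∎
  where
  open ≤-Reasoning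
  open import Data.List.Membership.DecPropositional _≟_ using (_∈?_)
  to : ∀ {x} → x ∈ xs → x ∈ filter (_∈? xs) (upTo n)
  to x∈xs = ∈-filter⁺ (_∈? xs) (∈-upTo⁺ (All.lookup bounded x∈xs)) x∈xs
  from : ∀ {x} → x ∈ filter (_∈? xs) (upTo n) → x ∈ xs
  from x∈ = proj₂ (∈-filter⁻ (_∈? xs) {xs = upTo n} x∈)

+-split-≤ : ∀ {a b v n} → v ≤ n → a + b ≡ n → a ≤ n ∸ v → b ≤ v → a ≡ n ∸ v × b ≡ v
+-split-≤ {a} {b} {v} {n} v≤n a+b≡n a≤n∸v b≤v = a≡n∸v , b≡v
  where
  n≤v+a : n ≤ v + a
  n≤v+a = subst (_≤ v + a) a+b≡n (subst (a + b ≤_) (+-comm a v) (+-monoʳ-≤ a b≤v))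
  a≡n∸v : a ≡ n ∸ v
  a≡n∸v = ≤-antisym a≤n∸v (m≤n+o⇒m∸n≤o n v n≤v+a)
  b≡v : b ≡ v
  b≡v = +-cancelˡ-≡ (n ∸ v) b v (trans (cong (_+ b) (sym a≡n∸v)) (trans a+b≡n (sym (m∸n+n≡m v≤n))))

∈-concatMap⁺′ : (f : A → List B) {x : A} {xs : List A} {y : B} →
  x ∈ xs → y ∈ f x → y ∈ concatMap f xs
∈-concatMap⁺′ f x∈xs y∈fx = ∈-concatMap⁺ f (lose x∈xs y∈fx)

∈-concatMap⁻′ : (f : A → List B) (xs : List A) {y : B} →
  y ∈ concatMap f xs → ∃[ x ] x ∈ xs × y ∈ f x
∈-concatMap⁻′ f xs y∈ = find (∈-concatMap⁻ f {xs = xs} y∈)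

Unique-concatMap⁺ : (f : A → List B) {xs : List A} → Unique xs →
  (∀ {x} → x ∈ xs → Unique (f x)) →
  (∀ {x x′ y} → x ∈ xs → x′ ∈ xs → y ∈ f x → y ∈ f x′ → x ≡ x′) →
  Unique (concatMap f xs)
Unique-concatMap⁺ f {[]} _ _ _ = []
Unique-concatMap⁺ f {x ∷ xs} (x∉xs ∷ uxs) ufs blocks =
  Unique.++⁺ (ufs (here refl))
    (Unique-concatMap⁺ f uxs (ufs ∘ there) λ p q → blocks (there p) (there q))
    λ (y∈fx , y∈rest) → disjoint y∈fx y∈rest
  where
  disjoint : ∀ {y} → y ∈ f x → y ∈ concatMap f xs → ⊥
  disjoint y∈fx y∈rest with ∈-concatMap⁻′ f xs y∈rest
  ... | x′ , x′∈xs , y∈fx′ = All.lookup x∉xs x′∈xs (blocks (here refl) (there x′∈xs) y∈fx y∈fx′)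

length-concatMap : (f : A → List B) (xs : List A) →
  length (concatMap f xs) ≡ sum (map (length ∘ f) xs)
length-concatMap f []       = refl
length-concatMap f (x ∷ xs) = trans (length-++ (f x)) (cong (length (f x) +_) (length-concatMap f xs))

length-concatMap-map : {C : Set} (g : A → B → C) (xs : List A) (ys : List B) →
  length (concatMap (λ x → map (g x) ys) xs) ≡ length xs * length ys
length-concatMap-map g []       ys = refl
length-concatMap-map g (x ∷ xs) ys = begin
  length (map (g x) ys ++ concatMap (λ x → map (g x) ys) xs)
    ≡⟨ length-++ (map (g x) ys) ⟩
  length (map (g x) ys) + length (concatMap (λ x → map (g x) ys) xs)
    ≡⟨ cong₂ _+_ (length-map (g x) ys) (length-concatMap-map g xs ys) ⟩
  length ys + length xs * length ys ∎
  where open ≡-Reasoning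

++-injective : ∀ {xs xs′ ys ys′ : List A} → length xs ≡ length xs′ →
  xs ++ ys ≡ xs′ ++ ys′ → xs ≡ xs′ × ys ≡ ys′
++-injective {xs = []}     {[]}       _   eq = refl , eq
++-injective {xs = x ∷ xs} {x′ ∷ xs′} {ys} {ys′} len eq
  with refl , refl ← ++-injective {xs = xs} {xs′} {ys} {ys′} (suc-injective len) (∷-injectiveʳ eq) =
  cong (_∷ xs) (∷-injectiveˡ eq) , refl

Unique-⊆ : ∀ {xs ys : List A} → xs ⊆ ys → Unique ys → Unique xs
Unique-⊆ []           _            = []
Unique-⊆ (_ ∷ʳ xs⊆)   (_ ∷ uys)    = Unique-⊆ xs⊆ uys
Unique-⊆ (refl ∷ xs⊆) (x∉ys ∷ uys) = All-resp-⊆ xs⊆ x∉ys ∷ Unique-⊆ xs⊆ uys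

⊆-map⁻ : (f : A → B) {xs : List B} (ys : List A) → xs ⊆ map f ys → ∃[ zs ] zs ⊆ ys × map f zs ≡ xs
⊆-map⁻ f []       []           = [] , [] , refl
⊆-map⁻ f (y ∷ ys) (_ ∷ʳ xs⊆)   with zs , zs⊆ys , refl ← ⊆-map⁻ f ys xs⊆ = zs , y ∷ʳ zs⊆ys , refl
⊆-map⁻ f (y ∷ ys) (refl ∷ xs⊆) with zs , zs⊆ys , refl ← ⊆-map⁻ f ys xs⊆ =
  y ∷ zs , refl ∷ zs⊆ys , refl

⊆-++⁻ : ∀ {xs} (ys : List A) {zs} → xs ⊆ ys ++ zs →
  ∃[ xs₁ ] ∃[ xs₂ ] xs₁ ++ xs₂ ≡ xs × xs₁ ⊆ ys × xs₂ ⊆ zs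
⊆-++⁻ []       xs⊆ = [] , _ , refl , [] , xs⊆
⊆-++⁻ (y ∷ ys) (_ ∷ʳ xs⊆) with xs₁ , xs₂ , refl , xs₁⊆ , xs₂⊆ ← ⊆-++⁻ ys xs⊆ =
  xs₁ , xs₂ , refl , y ∷ʳ xs₁⊆ , xs₂⊆
⊆-++⁻ (y ∷ ys) (refl ∷ xs⊆) with xs₁ , xs₂ , refl , xs₁⊆ , xs₂⊆ ← ⊆-++⁻ ys xs⊆ =
  y ∷ xs₁ , xs₂ , refl , refl ∷ xs₁⊆ , xs₂⊆

-- Finite sums and convolution of sequences ℕ → ℕ

∑< : ℕ → (ℕ → ℕ) → ℕ
∑< zero    f = 0
∑< (suc n) f = ∑< n f + f n

infixl 10 ∑<
syntax ∑< n (λ i → e) = ∑[ i < n ] e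

∑-cong : ∀ n {f g : ℕ → ℕ} → (∀ i → i < n → f i ≡ g i) → ∑< n f ≡ ∑< n g
∑-cong zero    f≗g = refl
∑-cong (suc n) f≗g = cong₂ _+_ (∑-cong n λ i i<n → f≗g i (m<n⇒m<1+n i<n)) (f≗g n (n<1+n n))

∑-zero : ∀ n {f : ℕ → ℕ} → (∀ i → i < n → f i ≡ 0) → ∑< n f ≡ 0
∑-zero zero    f≗0 = refl
∑-zero (suc n) f≗0 = cong₂ _+_ (∑-zero n λ i i<n → f≗0 i (m<n⇒m<1+n i<n)) (f≗0 n (n<1+n n))

∑-distrib-+ : ∀ n (f g : ℕ → ℕ) → ∑[ i < n ] (f i + g i) ≡ ∑< n f + ∑< n g
∑-distrib-+ zero    f g = refl
∑-distrib-+ (suc n) f g = begin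
  ∑[ i < n ] (f i + g i) + (f n + g n) ≡⟨ cong (_+ (f n + g n)) (∑-distrib-+ n f g) ⟩
  (∑< n f + ∑< n g) + (f n + g n)      ≡⟨ +-assoc (∑< n f) (∑< n g) (f n + g n) ⟩
  ∑< n f + (∑< n g + (f n + g n))      ≡⟨ cong (∑< n f +_) (+-comm (∑< n g) (f n + g n)) ⟩
  ∑< n f + ((f n + g n) + ∑< n g)      ≡⟨ cong (∑< n f +_) (+-assoc (f n) (g n) (∑< n g)) ⟩
  ∑< n f + (f n + (g n + ∑< n g))      ≡⟨ +-assoc (∑< n f) (f n) (g n + ∑< n g) ⟨
  (∑< n f + f n) + (g n + ∑< n g)      ≡⟨ cong ((∑< n f + f n) +_) (+-comm (g n) (∑< n g)) ⟩
  (∑< n f + f n) + (∑< n g + g n)      ∎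
  where open ≡-Reasoning

*-distribˡ-∑ : ∀ n c (f : ℕ → ℕ) → c * ∑< n f ≡ ∑[ i < n ] (c * f i)
*-distribˡ-∑ zero    c f = *-zeroʳ c
*-distribˡ-∑ (suc n) c f =
  trans (*-distribˡ-+ c (∑< n f) (f n)) (cong (_+ c * f n) (*-distribˡ-∑ n c f))

∑-peel : ∀ n (f : ℕ → ℕ) → ∑< (suc n) f ≡ f 0 + ∑[ i < n ] f (suc i)
∑-peel zero    f = +-comm 0 (f 0)
∑-peel (suc n) f = trans (cong (_+ f (suc n)) (∑-peel n f)) (+-assoc (f 0) _ _)

∑-reverse : ∀ n (f : ℕ → ℕ) → ∑< n f ≡ ∑[ i < n ] f (n ∸ suc i)
∑-reverse zero    f = refl
∑-reverse (suc n) f = begin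
  ∑< n f + f n                          ≡⟨ +-comm (∑< n f) (f n) ⟩
  f n + ∑< n f                          ≡⟨ cong (f n +_) (∑-reverse n f) ⟩
  f n + ∑[ i < n ] f (n ∸ suc i)        ≡⟨ ∑-peel n (λ i → f (n ∸ i)) ⟨
  ∑[ i < suc n ] f (suc n ∸ suc i)      ∎
  where open ≡-Reasoning

select : {P : Set} → Dec P → ℕ → ℕ
select d x = if does d then x else 0

select-yes : {P : Set} (d : Dec P) {x : ℕ} → P → select d x ≡ x
select-yes (yes _) _ = refl
select-yes (no ¬p) p = ⊥-elim (¬p p)

select-no : {P : Set} (d : Dec P) {x : ℕ} → ¬ P → select d x ≡ 0
select-no (yes p) ¬p = ⊥-elim (¬p p)
select-no (no _)  _  = refl

select-*ˡ : {P : Set} (d : Dec P) (x y : ℕ) → select d x * y ≡ select d (x * y)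
select-*ˡ (yes _) x y = refl
select-*ˡ (no _)  x y = refl

select-cong : {P Q : Set} (p : Dec P) (q : Dec Q) {x : ℕ} →
  (P → Q) → (Q → P) → select p x ≡ select q x
select-cong (yes _) (yes _) _  _  = refl
select-cong (no _)  (no _)  _  _  = refl
select-cong (yes p) (no ¬q) to _  = ⊥-elim (¬q (to p))
select-cong (no ¬p) (yes q) _ from = ⊥-elim (¬p (from q))

select-congʳ : {P : Set} (d : Dec P) {x y : ℕ} → (P → x ≡ y) → select d x ≡ select d y
select-congʳ (yes p) eq = eq p
select-congʳ (no _)  eq = refl

select-*-congʳ : {P : Set} (d : Dec P) (x : ℕ) {y y′ : ℕ} →
  (P → y ≡ y′) → select d x * y ≡ select d x * y′
select-*-congʳ (yes p) x eq = cong (x *_) (eq p)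
select-*-congʳ (no _)  x eq = refl

∑-select : ∀ n {P : Set} (d : Dec P) (f : ℕ → ℕ) → ∑[ i < n ] select d (f i) ≡ select d (∑< n f)
∑-select n (yes _) f = refl
∑-select n (no _)  f = ∑-zero n λ _ _ → refl

sum-filter-upTo : {P : ℕ → Set} (P? : Decidable P) (f : ℕ → ℕ) (n : ℕ) →
  sum (map f (filter P? (upTo n))) ≡ ∑[ i < n ] select (P? i) (f i)
sum-filter-upTo P? f zero    = refl
sum-filter-upTo P? f (suc n) = begin
  sum (map f (filter P? (upTo (suc n))))
    ≡⟨ cong (λ xs → sum (map f (filter P? xs))) (upTo-∷ʳ n) ⟨
  sum (map f (filter P? (upTo n ++ n ∷ [])))
    ≡⟨ cong (λ xs → sum (map f xs)) (filter-++ P? (upTo n) (n ∷ [])) ⟩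
  sum (map f (filter P? (upTo n) ++ filter P? (n ∷ [])))
    ≡⟨ cong sum (map-++ f (filter P? (upTo n)) _) ⟩
  sum (map f (filter P? (upTo n)) ++ map f (filter P? (n ∷ [])))
    ≡⟨ sum-++ (map f (filter P? (upTo n))) _ ⟩
  sum (map f (filter P? (upTo n))) + sum (map f (filter P? (n ∷ [])))
    ≡⟨ cong₂ _+_ (sum-filter-upTo P? f n) last ⟩
  ∑[ i < n ] select (P? i) (f i) + select (P? n) (f n) ∎
  where
  open ≡-Reasoning
  last : sum (map f (filter P? (n ∷ []))) ≡ select (P? n) (f n)
  last with P? n
  ... | yes _ = +-identityʳ (f n)
  ... | no _  = refl

infixl 7 _⋆_

_⋆_ : (ℕ → ℕ) → (ℕ → ℕ) → ℕ → ℕ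
(f ⋆ g) m = ∑[ i < suc m ] (f i * g (m ∸ i))

-- Multiplication of a generating function by z.
shift : (ℕ → ℕ) → ℕ → ℕ
shift f zero    = 0
shift f (suc i) = f i

⋆-cong-terms : ∀ m {f f′ g g′ : ℕ → ℕ} →
  (∀ i → i ≤ m → f i * g (m ∸ i) ≡ f′ i * g′ (m ∸ i)) → (f ⋆ g) m ≡ (f′ ⋆ g′) m
⋆-cong-terms m eq = ∑-cong (suc m) λ i i<1+m → eq i (s≤s⁻¹ i<1+m)

⋆-cong : ∀ m {f f′ g g′ : ℕ → ℕ} →
  (∀ i → i ≤ m → f i ≡ f′ i) → (∀ i → i ≤ m → g i ≡ g′ i) → (f ⋆ g) m ≡ (f′ ⋆ g′) m
⋆-cong m {f} {f′} {g} {g′} f≗f′ g≗g′ = ⋆-cong-terms m {f} {f′} {g} {g′} λ i i≤m →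
  cong₂ _*_ (f≗f′ i i≤m) (g≗g′ (m ∸ i) (m∸n≤m m i))

⋆-comm : ∀ (f g : ℕ → ℕ) m → (f ⋆ g) m ≡ (g ⋆ f) m
⋆-comm f g m = trans (∑-reverse (suc m) _) (∑-cong (suc m) λ i i<1+m → begin
  f (m ∸ i) * g (m ∸ (m ∸ i)) ≡⟨ cong (λ j → f (m ∸ i) * g j) (m∸[m∸n]≡n (s≤s⁻¹ i<1+m)) ⟩
  f (m ∸ i) * g i             ≡⟨ *-comm (f (m ∸ i)) (g i) ⟩
  g i * f (m ∸ i)             ∎)
  where open ≡-Reasoning

⋆-peel : ∀ (f g : ℕ → ℕ) m → (f ⋆ g) (suc m) ≡ f 0 * g (suc m) + ((f ∘ suc) ⋆ g) m
⋆-peel f g m = ∑-peel (suc m) _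

⋆-shiftˡ : ∀ (f g : ℕ → ℕ) m → (shift f ⋆ g) (suc m) ≡ (f ⋆ g) m
⋆-shiftˡ f g m = ⋆-peel (shift f) g m

⋆-shiftʳ : ∀ (f g : ℕ → ℕ) m → (f ⋆ shift g) (suc m) ≡ (f ⋆ g) m
⋆-shiftʳ f g m = trans (⋆-comm f (shift g) (suc m)) (trans (⋆-shiftˡ g f m) (⋆-comm g f m))

-- f = f 0 + z (f ∘ suc) as generating functions, multiplied by g.
⋆-unfold : ∀ (f g : ℕ → ℕ) m → (f ⋆ g) m ≡ f 0 * g m + shift ((f ∘ suc) ⋆ g) m
⋆-unfold f g zero    = +-comm 0 (f 0 * g 0)
⋆-unfold f g (suc m) = ⋆-peel f g m

⋆-linearˡ : ∀ c (g h k : ℕ → ℕ) m → ((λ i → c * g i + h i) ⋆ k) m ≡ c * (g ⋆ k) m + (h ⋆ k) m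
⋆-linearˡ c g h k m = begin
  ∑[ i < suc m ] ((c * g i + h i) * k (m ∸ i))
    ≡⟨ ∑-cong (suc m) (λ i _ → trans (*-distribʳ-+ (k (m ∸ i)) (c * g i) (h i))
                                      (cong (_+ h i * k (m ∸ i)) (*-assoc c (g i) (k (m ∸ i))))) ⟩
  ∑[ i < suc m ] (c * (g i * k (m ∸ i)) + h i * k (m ∸ i))
    ≡⟨ ∑-distrib-+ (suc m) _ _ ⟩
  ∑[ i < suc m ] (c * (g i * k (m ∸ i))) + (h ⋆ k) m
    ≡⟨ cong (_+ (h ⋆ k) m) (*-distribˡ-∑ (suc m) c _) ⟨
  c * (g ⋆ k) m + (h ⋆ k) m ∎
  where open ≡-Reasoning

⋆-assoc : ∀ (f g h : ℕ → ℕ) m → ((f ⋆ g) ⋆ h) m ≡ (f ⋆ (g ⋆ h)) m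
⋆-assoc f g h m = begin
  ((f ⋆ g) ⋆ h) m
    ≡⟨ ⋆-cong m {g = h} (λ i _ → ⋆-unfold f g i) (λ _ _ → refl) ⟩
  ((λ i → f 0 * g i + shift ((f ∘ suc) ⋆ g) i) ⋆ h) m
    ≡⟨ ⋆-linearˡ (f 0) g _ h m ⟩
  f 0 * (g ⋆ h) m + (shift ((f ∘ suc) ⋆ g) ⋆ h) m
    ≡⟨ cong (f 0 * (g ⋆ h) m +_) (tail m) ⟩
  f 0 * (g ⋆ h) m + shift ((f ∘ suc) ⋆ (g ⋆ h)) m
    ≡⟨ ⋆-unfold f (g ⋆ h) m ⟨
  (f ⋆ (g ⋆ h)) m ∎
  where
  open ≡-Reasoning
  tail : ∀ m → (shift ((f ∘ suc) ⋆ g) ⋆ h) m ≡ shift ((f ∘ suc) ⋆ (g ⋆ h)) m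
  tail zero    = refl
  tail (suc m) = trans (⋆-shiftˡ _ h m) (⋆-assoc (f ∘ suc) g h m)

-- Congruence modulo k, and sequences sieved by residue class

module Modular (k : ℕ) .{{_ : NonZero k}} where

  infix 4 _≈_ _≈?_

  _≈_ : ℕ → ℕ → Set
  x ≈ y = x % k ≡ y % k

  _≈?_ : (x y : ℕ) → Dec (x ≈ y)
  x ≈? y = x % k ≟ y % k

  0%k≡0 : 0 % k ≡ 0
  0%k≡0 = m<n⇒m%n≡m (>-nonZero⁻¹ k)

  +-≈ : ∀ {a b c d} → a ≈ b → c ≈ d → a + c ≈ b + d
  +-≈ {a} {b} {c} {d} a≈b c≈d = begin
    (a + c) % k         ≡⟨ %-distribˡ-+ a c k ⟩
    (a % k + c % k) % k ≡⟨ cong₂ (λ x y → (x + y) % k) a≈b c≈d ⟩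
    (b % k + d % k) % k ≡⟨ %-distribˡ-+ b d k ⟨
    (b + d) % k         ∎
    where open ≡-Reasoning

  +-cancelˡ-≈ : ∀ d {x y} → d + x ≈ d + y → x ≈ y
  +-cancelˡ-≈ d {x} {y} eq = begin
    x % k             ≡⟨ +-≈ {c = x} c+d≈0 refl ⟨
    (c + d + x) % k   ≡⟨ cong (_% k) (+-assoc c d x) ⟩
    (c + (d + x)) % k ≡⟨ +-≈ {c} refl eq ⟩
    (c + (d + y)) % k ≡⟨ cong (_% k) (+-assoc c d y) ⟨
    (c + d + y) % k   ≡⟨ +-≈ {c = y} c+d≈0 refl ⟩
    y % k             ∎
    where
    open ≡-Reasoning
    c = k ∸ d % k
    c+d≈0 : c + d ≈ 0
    c+d≈0 = begin
      (c + d) % k       ≡⟨ +-≈ {c} refl (m%n%n≡m%n d k) ⟨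
      (c + d % k) % k   ≡⟨ cong (_% k) (m∸n+n≡m (m%n≤n d k)) ⟩
      k % k             ≡⟨ n%n≡0 k ⟩
      0                 ≡⟨ 0%k≡0 ⟨
      0 % k             ∎

  +-absorbʳ-≈ : ∀ x {i} → i ≈ 0 → x + i ≈ x
  +-absorbʳ-≈ x i≈0 = trans (+-≈ {x} refl i≈0) (cong (_% k) (+-identityʳ x))

  ∣⇒≈0 : ∀ {j} → k ∣ j → j ≈ 0
  ∣⇒≈0 {j} k∣j = trans (n∣m⇒m%n≡0 j k k∣j) (sym 0%k≡0)

  ≈0⇒∣ : ∀ {j} → j ≈ 0 → k ∣ j
  ≈0⇒∣ {j} j≈0 = m%n≡0⇒n∣m j k (trans j≈0 0%k≡0)

  suc-+0-≈ : ∀ {v t} → v ≈ t → suc v + 0 ≈ suc t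
  suc-+0-≈ {v} v≈t = +-≈ {1} refl (trans (cong (_% k) (+-identityʳ v)) v≈t)

  1≈0⇒≈0 : 1 ≈ 0 → ∀ x → x ≈ 0
  1≈0⇒≈0 1≈0 zero    = refl
  1≈0⇒≈0 1≈0 (suc x) = +-≈ 1≈0 (1≈0⇒≈0 1≈0 x)

  -- restrict s r f keeps the f i with s + i ≡ r (mod k): the class r - s, without truncated subtraction.
  restrict : ℕ → ℕ → (ℕ → ℕ) → ℕ → ℕ
  restrict s r f i = select (s + i ≈? r) (f i)

  restrict-zero : ∀ {s r} (f : ℕ → ℕ) → ¬ s ≈ r → restrict s r f 0 ≡ 0
  restrict-zero {s} {r} f s≉r = select-no (s + 0 ≈? r) (s≉r ∘ trans (cong (_% k) (sym (+-identityʳ s))))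

  restrict-suc-cancel : ∀ s r (f : ℕ → ℕ) i → restrict (suc s) (suc r) f i ≡ restrict s r f i
  restrict-suc-cancel s r f i = select-cong (suc s + i ≈? suc r) (s + i ≈? r) (+-cancelˡ-≈ 1) (+-≈ {1} refl)

  -- B = 1 + z B₀ B at the coefficient of z^(u+1), where B₀ is the part of B on multiples of k.
  SievedRecurrence : (ℕ → ℕ) → ℕ → Set
  SievedRecurrence b u = b (suc u) ≡ (restrict 0 0 b ⋆ b) u

  restrict-suc : ∀ s r (b : ℕ → ℕ) u → SievedRecurrence b u →
    restrict s r b (suc u) ≡ (restrict 0 0 b ⋆ restrict (suc s) r b) u
  restrict-suc s r b u rec = sym (begin
    (restrict 0 0 b ⋆ restrict (suc s) r b) u
      ≡⟨ ∑-cong (suc u) (λ i i<1+u → term i (s≤s⁻¹ i<1+u)) ⟩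
    ∑[ i < suc u ] select (s + suc u ≈? r) (restrict 0 0 b i * b (u ∸ i))
      ≡⟨ ∑-select (suc u) (s + suc u ≈? r) _ ⟩
    select (s + suc u ≈? r) ((restrict 0 0 b ⋆ b) u)
      ≡⟨ cong (select (s + suc u ≈? r)) rec ⟨
    restrict s r b (suc u) ∎)
    where
    open ≡-Reasoning
    same-class : ∀ {i} → i ≈ 0 → i ≤ u → suc s + (u ∸ i) ≈ s + suc u
    same-class {i} i≈0 i≤u = begin
      (suc s + (u ∸ i)) % k     ≡⟨ +-absorbʳ-≈ (suc s + (u ∸ i)) i≈0 ⟨
      (suc s + (u ∸ i) + i) % k ≡⟨ cong (_% k) (trans (+-assoc (suc s) (u ∸ i) i)
                                                     (cong (suc s +_) (m∸n+n≡m i≤u))) ⟩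
      (suc s + u) % k           ≡⟨ cong (_% k) (sym (+-suc s u)) ⟩
      (s + suc u) % k           ∎
    term : ∀ i → i ≤ u → restrict 0 0 b i * restrict (suc s) r b (u ∸ i)
                       ≡ select (s + suc u ≈? r) (restrict 0 0 b i * b (u ∸ i))
    term i i≤u = begin
      restrict 0 0 b i * restrict (suc s) r b (u ∸ i)
        ≡⟨ select-*-congʳ (i ≈? 0) (b i) (λ i≈0 → select-cong (suc s + (u ∸ i) ≈? r) (s + suc u ≈? r)
                             (trans (sym (same-class i≈0 i≤u))) (trans (same-class i≈0 i≤u))) ⟩
      restrict 0 0 b i * select (s + suc u ≈? r) (b (u ∸ i))
        ≡⟨ *-comm (restrict 0 0 b i) _ ⟩
      select (s + suc u ≈? r) (b (u ∸ i)) * restrict 0 0 b i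
        ≡⟨ select-*ˡ (s + suc u ≈? r) (b (u ∸ i)) _ ⟩
      select (s + suc u ≈? r) (b (u ∸ i) * restrict 0 0 b i)
        ≡⟨ cong (select (s + suc u ≈? r)) (*-comm (b (u ∸ i)) _) ⟩
      select (s + suc u ≈? r) (restrict 0 0 b i * b (u ∸ i)) ∎

  complement-class : ∀ {i s m} → i ≈ s → i ≤ m → suc m ≈ 0 → suc s + (m ∸ i) ≈ 0
  complement-class {i} {s} {m} i≈s i≤m 1+m≈0 = begin
    (suc s + (m ∸ i)) % k ≡⟨ +-≈ {suc s} {suc i} (+-≈ {1} refl (sym i≈s)) refl ⟩
    (suc i + (m ∸ i)) % k ≡⟨ cong (λ x → suc x % k) (m+[n∸m]≡n i≤m) ⟩
    suc m % k             ≡⟨ 1+m≈0 ⟩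
    0 % k                 ∎
    where open ≡-Reasoning

  restrict-complement : ∀ s (b : ℕ → ℕ) m → suc m ≈ 0 →
    (restrict 0 s b ⋆ b) m ≡ (restrict 0 s b ⋆ restrict (suc s) 0 b) m
  restrict-complement s b m 1+m≈0 =
    ⋆-cong-terms m {restrict 0 s b} {restrict 0 s b} {b} {restrict (suc s) 0 b} λ i i≤m →
      select-*-congʳ (i ≈? s) (b i) λ i≈s →
        sym (select-yes (suc s + (m ∸ i) ≈? 0) (complement-class i≈s i≤m 1+m≈0))

  -- With B_t the part of B on indices ≡ t, the recurrence gives B_(t+1) = z B₀ B_t when t + 1 ≢ 0,
  -- so for m ≡ -1 both sides equal (B_t ⋆ B₀ ⋆ B_(-t-2))(m - 1).
  restrict-⋆-step : ∀ s (b : ℕ → ℕ) m → suc m ≈ 0 → ¬ suc s ≈ 0 →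
    (∀ u → u < m → SievedRecurrence b u) →
    (restrict 0 (suc s) b ⋆ b) m ≡ (restrict 0 s b ⋆ b) m
  restrict-⋆-step s b zero    1≈0     1+s≉0 _   = ⊥-elim (1+s≉0 (1≈0⇒≈0 1≈0 (suc s)))
  restrict-⋆-step s b (suc m) 2+m≈0   1+s≉0 rec = begin
    (restrict 0 (suc s) b ⋆ b) (suc m)
      ≡⟨ restrict-complement (suc s) b (suc m) 2+m≈0 ⟩
    (restrict 0 (suc s) b ⋆ C) (suc m)
      ≡⟨ ⋆-cong (suc m) {g = C} left (λ _ _ → refl) ⟩
    (shift (B₀ ⋆ restrict 0 s b) ⋆ C) (suc m)
      ≡⟨ ⋆-shiftˡ (B₀ ⋆ restrict 0 s b) C m ⟩
    ((B₀ ⋆ restrict 0 s b) ⋆ C) m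
      ≡⟨ ⋆-cong m {g = C} (λ i _ → ⋆-comm B₀ (restrict 0 s b) i) (λ _ _ → refl) ⟩
    ((restrict 0 s b ⋆ B₀) ⋆ C) m
      ≡⟨ ⋆-assoc (restrict 0 s b) B₀ C m ⟩
    (restrict 0 s b ⋆ (B₀ ⋆ C)) m
      ≡⟨ ⋆-shiftʳ (restrict 0 s b) (B₀ ⋆ C) m ⟨
    (restrict 0 s b ⋆ shift (B₀ ⋆ C)) (suc m)
      ≡⟨ ⋆-cong (suc m) {f = restrict 0 s b} (λ _ _ → refl) right ⟩
    (restrict 0 s b ⋆ restrict (suc s) 0 b) (suc m)
      ≡⟨ restrict-complement s b (suc m) 2+m≈0 ⟨
    (restrict 0 s b ⋆ b) (suc m) ∎
    where
    open ≡-Reasoning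
    B₀ = restrict 0 0 b
    C  = restrict (suc (suc s)) 0 b
    left : ∀ i → i ≤ suc m → restrict 0 (suc s) b i ≡ shift (B₀ ⋆ restrict 0 s b) i
    left zero    _       = restrict-zero b (1+s≉0 ∘ sym)
    left (suc u) 1+u≤1+m = begin
      restrict 0 (suc s) b (suc u)        ≡⟨ restrict-suc 0 (suc s) b u (rec u 1+u≤1+m) ⟩
      (B₀ ⋆ restrict 1 (suc s) b) u       ≡⟨ ⋆-cong u {f = B₀} (λ _ _ → refl)
                                                    (λ i _ → restrict-suc-cancel 0 s b i) ⟩
      (B₀ ⋆ restrict 0 s b) u             ∎
    right : ∀ i → i ≤ suc m → shift (B₀ ⋆ C) i ≡ restrict (suc s) 0 b i
    right zero    _       = sym (restrict-zero b 1+s≉0)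
    right (suc u) 1+u≤1+m = sym (restrict-suc (suc s) 0 b u (rec u 1+u≤1+m))

  restrict-⋆-invariant : ∀ (b : ℕ → ℕ) m → suc m ≈ 0 → (∀ u → u < m → SievedRecurrence b u) →
    ∀ t → (restrict 0 t b ⋆ b) m ≡ (restrict 0 0 b ⋆ b) m
  restrict-⋆-invariant b m 1+m≈0 rec zero = refl
  restrict-⋆-invariant b m 1+m≈0 rec (suc s) with suc s ≈? 0
  ... | yes 1+s≈0 = ⋆-cong m {g = b}
    (λ i _ → select-cong (i ≈? suc s) (i ≈? 0) (λ p → trans p 1+s≈0) (λ p → trans p (sym 1+s≈0)))
    (λ _ _ → refl)
  ... | no  1+s≉0 = trans (restrict-⋆-step s b m 1+m≈0 1+s≉0 rec) (restrict-⋆-invariant b m 1+m≈0 rec s)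

-- The pattern 213 in lists of naturals

Has213 : List ℕ → Set
Has213 ℓ = ∃[ x ] ∃[ y ] ∃[ z ] (x ∷ y ∷ z ∷ []) ⊆ ℓ × y < x × x < z

Has213-⊆ : ∀ {ℓ ℓ′} → ℓ ⊆ ℓ′ → Has213 ℓ → Has213 ℓ′
Has213-⊆ ℓ⊆ℓ′ (x , y , z , xyz⊆ℓ , y<x , x<z) = x , y , z , ⊆-trans xyz⊆ℓ ℓ⊆ℓ′ , y<x , x<z

Has213-map⁺ : ∀ d ℓ → Has213 ℓ → Has213 (map (d +_) ℓ)
Has213-map⁺ d ℓ (x , y , z , xyz⊆ℓ , y<x , x<z) =
  d + x , d + y , d + z , ⊆-map⁺ (d +_) xyz⊆ℓ , +-monoʳ-< d y<x , +-monoʳ-< d x<z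

Has213-map⁻ : ∀ d ℓ → Has213 (map (d +_) ℓ) → Has213 ℓ
Has213-map⁻ d ℓ (_ , _ , _ , xyz⊆ , y<x , x<z) with ⊆-map⁻ (d +_) ℓ xyz⊆
... | x ∷ y ∷ z ∷ [] , xyz⊆ℓ , refl = x , y , z , xyz⊆ℓ , +-cancelˡ-< d y x y<x , +-cancelˡ-< d x z x<z

module _ {v : ℕ} {H L : List ℕ} (H>v : All (v <_) H) (L<v : All (_< v) L) where

  private
    straddle : ∀ {x z} → x < z → v < x → z < v → ⊥
    straddle x<z v<x z<v = <-asym x<z (<-trans z<v v<x)

  Has213-++⁻ : Has213 (H ++ L) → Has213 H ⊎ Has213 L
  Has213-++⁻ (x , y , z , xyz⊆ , y<x , x<z) with ⊆-++⁻ H xyz⊆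
  ... | [] , _ , refl , _ , xyz⊆L = inj₂ (x , y , z , xyz⊆L , y<x , x<z)
  ... | _ ∷ [] , _ , refl , x⊆H , yz⊆L
        with v<x ∷ _ ← All-resp-⊆ x⊆H H>v | _ ∷ z<v ∷ _ ← All-resp-⊆ yz⊆L L<v =
        ⊥-elim (straddle x<z v<x z<v)
  ... | _ ∷ _ ∷ [] , _ , refl , xy⊆H , z⊆L
        with v<x ∷ _ ← All-resp-⊆ xy⊆H H>v | z<v ∷ _ ← All-resp-⊆ z⊆L L<v =
        ⊥-elim (straddle x<z v<x z<v)
  ... | _ ∷ _ ∷ _ ∷ [] , [] , refl , xyz⊆H , _ = inj₁ (x , y , z , xyz⊆H , y<x , x<z)

  Has213-∷⁻ : Has213 (v ∷ H ++ L) → Has213 (H ++ L)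
  Has213-∷⁻ (x , y , z , _ ∷ʳ xyz⊆ , y<x , x<z) = x , y , z , xyz⊆ , y<x , x<z
  Has213-∷⁻ (v , y , z , refl ∷ yz⊆ , y<v , v<z) with ⊆-++⁻ H yz⊆
  ... | [] , _ , refl , _ , yz⊆L with _ ∷ z<v ∷ _ ← All-resp-⊆ yz⊆L L<v = ⊥-elim (<-asym v<z z<v)
  ... | _ ∷ [] , _ , refl , y⊆H , _ with v<y ∷ _ ← All-resp-⊆ y⊆H H>v = ⊥-elim (<-asym y<v v<y)
  ... | _ ∷ _ ∷ [] , [] , refl , yz⊆H , _ with v<y ∷ _ ← All-resp-⊆ yz⊆H H>v = ⊥-elim (<-asym y<v v<y)

dropWhile-above-below : ∀ v (above? : Decidable (v <_)) rest → All (v ≢_) rest → ¬ Has213 (v ∷ rest) →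
  All (_< v) (dropWhile above? rest)
dropWhile-above-below v above? []       _              _       = []
dropWhile-above-below v above? (x ∷ xs) (v≢x ∷ v∉xs) avoids with above? x
... | yes _   = dropWhile-above-below v above? xs v∉xs (avoids ∘ Has213-⊆ (refl ∷ (x ∷ʳ ⊆-refl)))
... | no  v≮x = x<v ∷ All.tabulate below
  where
  x<v : x < v
  x<v = ≤∧≢⇒< (≮⇒≥ v≮x) (≢-sym v≢x)
  below : ∀ {z} → z ∈ xs → z < v
  below {z} z∈xs with <-cmp z v
  ... | tri< z<v _ _ = z<v
  ... | tri≈ _ z≡v _ = ⊥-elim (All.lookup v∉xs z∈xs (sym z≡v))
  ... | tri> _ _ v<z = ⊥-elim (avoids (v , x , z , refl ∷ refl ∷ from∈ z∈xs , x<v , v<z))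

values : ∀ {n m} → Vec (Fin n) m → List ℕ
values []      = []
values (x ∷ w) = toℕ x ∷ values w

val : ∀ {n m} → Vec (Fin n) m → Fin m → ℕ
val w i = toℕ (lookup w i)

values-injective : ∀ {n m} (w w′ : Vec (Fin n) m) → values w ≡ values w′ → w ≡ w′
values-injective []      []        _  = refl
values-injective (x ∷ w) (x′ ∷ w′) eq =
  cong₂ _∷_ (Fin.toℕ-injective (∷-injectiveˡ eq)) (values-injective w w′ (∷-injectiveʳ eq))

length-values : ∀ {n m} (w : Vec (Fin n) m) → length (values w) ≡ m
length-values []      = refl
length-values (x ∷ w) = cong suc (length-values w)

All-values : ∀ {n m} {P : ℕ → Set} (w : Vec (Fin n) m) → (∀ i → P (val w i)) → All P (values w)
All-values []      P-val = []
All-values (x ∷ w) P-val = P-val Fin.zero ∷ All-values w (P-val ∘ Fin.suc)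

All-values⁻ : ∀ {n m} {P : ℕ → Set} (w : Vec (Fin n) m) → All P (values w) → ∀ i → P (val w i)
All-values⁻ (x ∷ w) (px ∷ _)   Fin.zero    = px
All-values⁻ (x ∷ w) (_  ∷ pxs) (Fin.suc i) = All-values⁻ w pxs i

values-bounded : ∀ {n m} (w : Vec (Fin n) m) → All (_< n) (values w)
values-bounded w = All-values w λ i → Fin.toℕ<n (lookup w i)

fromValues : ∀ {n} m (ℓ : List ℕ) → length ℓ ≡ m → All (_< n) ℓ → ∃[ w ] values {n} {m} w ≡ ℓ
fromValues zero    []      _   []         = [] , refl
fromValues (suc m) (x ∷ ℓ) len (x<n ∷ ℓ<n) with w , refl ← fromValues m ℓ (suc-injective len) ℓ<n =
  fromℕ< x<n ∷ w , cong (_∷ values w) (Fin.toℕ-fromℕ< x<n)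

Injective-lookup : ∀ {n m} → Vec (Fin n) m → Set
Injective-lookup {m = m} w = ∀ (i j : Fin m) → lookup w i ≡ lookup w j → i ≡ j

injective⇒Unique-values : ∀ {n m} (w : Vec (Fin n) m) → Injective-lookup w → Unique (values w)
injective⇒Unique-values []      _   = []
injective⇒Unique-values (x ∷ w) inj =
  All-values w (λ j x≡wj → Fin.0≢1+n (inj Fin.zero (Fin.suc j) (Fin.toℕ-injective x≡wj)))
  ∷ injective⇒Unique-values w (λ i j wi≡wj → Fin.suc-injective (inj (Fin.suc i) (Fin.suc j) wi≡wj))

Unique-values⇒injective : ∀ {n m} (w : Vec (Fin n) m) → Unique (values w) → Injective-lookup w
Unique-values⇒injective (x ∷ w) _            Fin.zero    Fin.zero    _  = refl
Unique-values⇒injective (x ∷ w) (x∉w ∷ _)    Fin.zero    (Fin.suc j) eq =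
  ⊥-elim (All-values⁻ w x∉w j (cong toℕ eq))
Unique-values⇒injective (x ∷ w) (x∉w ∷ _)    (Fin.suc i) Fin.zero    eq =
  ⊥-elim (All-values⁻ w x∉w i (cong toℕ (sym eq)))
Unique-values⇒injective (x ∷ w) (_ ∷ unique) (Fin.suc i) (Fin.suc j) eq =
  cong Fin.suc (Unique-values⇒injective w unique i j eq)

∈-allWords : ∀ m n (w : Vec (Fin n) m) → w ∈ allWords m n
∈-allWords zero    n []      = here refl
∈-allWords (suc m) n (x ∷ w) =
  ∈-concatMap⁺′ (λ w′ → map (_∷ w′) (allFin n)) (∈-allWords m n w) (∈-map⁺ (_∷ w) (∈-allFin x))

allWords-Unique : ∀ m n → Unique (allWords m n)
allWords-Unique zero    n = [] ∷ []
allWords-Unique (suc m) n =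
  Unique-concatMap⁺ (λ w → map (_∷ w) (allFin n)) (allWords-Unique m n)
    (λ _ → Unique.map⁺ Vec.∷-injectiveˡ (Unique.allFin⁺ n))
    λ _ _ p q → same-tail (∈-map⁻ _ p) (∈-map⁻ _ q)
  where
  same-tail : ∀ {w w′ : Vec (Fin n) m} {y} →
    ∃[ x ] x ∈ allFin n × y ≡ x ∷ w → ∃[ x ] x ∈ allFin n × y ≡ x ∷ w′ → w ≡ w′
  same-tail (_ , _ , refl) (_ , _ , eq) = Vec.∷-injectiveʳ eq

⊆-values¹ : ∀ {n m} (w : Vec (Fin n) m) i → (val w i ∷ []) ⊆ values w
⊆-values¹ (x ∷ w) Fin.zero    = refl ∷ minimum (values w)
⊆-values¹ (x ∷ w) (Fin.suc i) = toℕ x ∷ʳ ⊆-values¹ w i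

⊆-values² : ∀ {n m} (w : Vec (Fin n) m) i j → i Fin.< j → (val w i ∷ val w j ∷ []) ⊆ values w
⊆-values² (x ∷ w) Fin.zero    (Fin.suc j) _   = refl ∷ ⊆-values¹ w j
⊆-values² (x ∷ w) (Fin.suc i) (Fin.suc j) i<j = toℕ x ∷ʳ ⊆-values² w i j (s≤s⁻¹ i<j)

⊆-values³ : ∀ {n m} (w : Vec (Fin n) m) i j l → i Fin.< j → j Fin.< l →
  (val w i ∷ val w j ∷ val w l ∷ []) ⊆ values w
⊆-values³ (x ∷ w) Fin.zero    (Fin.suc j) (Fin.suc l) _   j<l = refl ∷ ⊆-values² w j l (s≤s⁻¹ j<l)
⊆-values³ (x ∷ w) (Fin.suc i) (Fin.suc j) (Fin.suc l) i<j j<l =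
  toℕ x ∷ʳ ⊆-values³ w i j l (s≤s⁻¹ i<j) (s≤s⁻¹ j<l)

values-⊆¹ : ∀ {n m} (w : Vec (Fin n) m) {x xs} → (x ∷ xs) ⊆ values w → ∃[ i ] val w i ≡ x
values-⊆¹ (_ ∷ w) (_ ∷ʳ x⊆)  with i , refl ← values-⊆¹ w x⊆ = Fin.suc i , refl
values-⊆¹ (_ ∷ w) (refl ∷ _) = Fin.zero , refl

values-⊆² : ∀ {n m} (w : Vec (Fin n) m) {x y xs} → (x ∷ y ∷ xs) ⊆ values w →
  ∃[ i ] ∃[ j ] i Fin.< j × val w i ≡ x × val w j ≡ y
values-⊆² (_ ∷ w) (_ ∷ʳ xy⊆) with i , j , i<j , refl , refl ← values-⊆² w xy⊆ =
  Fin.suc i , Fin.suc j , s<s i<j , refl , refl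
values-⊆² (_ ∷ w) (refl ∷ y⊆) with j , refl ← values-⊆¹ w y⊆ = Fin.zero , Fin.suc j , z<s , refl , refl

values-⊆³ : ∀ {n m} (w : Vec (Fin n) m) {x y z} → (x ∷ y ∷ z ∷ []) ⊆ values w →
  ∃[ i ] ∃[ j ] ∃[ l ] i Fin.< j × j Fin.< l × val w i ≡ x × val w j ≡ y × val w l ≡ z
values-⊆³ (_ ∷ w) (_ ∷ʳ xyz⊆) with i , j , l , i<j , j<l , refl , refl , refl ← values-⊆³ w xyz⊆ =
  Fin.suc i , Fin.suc j , Fin.suc l , s<s i<j , s<s j<l , refl , refl , refl
values-⊆³ (_ ∷ w) (refl ∷ yz⊆) with j , l , j<l , refl , refl ← values-⊆² w yz⊆ =
  Fin.zero , Fin.suc j , Fin.suc l , z<s , s<s j<l , refl , refl , refl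

p213-IsPerm : IsPerm p213
p213-IsPerm = toWitness {a? = isPerm? p213} tt

p132-IsPerm : IsPerm p132
p132-IsPerm = toWitness {a? = isPerm? p132} tt

OrderIso-monotone : ∀ {n} (w : Vec (Fin n) n) σ p → IsPerm σ →
  (∀ a b → lookup σ a Fin.< lookup σ b → lookup w (p a) Fin.< lookup w (p b)) → OrderIso w σ p
OrderIso-monotone w σ p σ-perm mono a b = reflect , mono a b
  where
  reflect : lookup w (p a) Fin.< lookup w (p b) → lookup σ a Fin.< lookup σ b
  reflect wa<wb with Fin.<-cmp (lookup σ a) (lookup σ b)
  ... | tri< σa<σb _ _ = σa<σb
  ... | tri≈ _ σa≡σb _ rewrite σ-perm a b σa≡σb = ⊥-elim (Fin.<-irrefl refl wa<wb)
  ... | tri> _ _ σa>σb = ⊥-elim (Fin.<-asym wa<wb (mono b a σa>σb))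

module _ {n} (w : Vec (Fin n) n) (i j l : Fin n) where

  OrderIso-213⁻ : OrderIso w p213 (triple i j l) → val w j < val w i × val w i < val w l
  OrderIso-213⁻ iso = proj₂ (iso 1F 0F) (s≤s z≤n) , proj₂ (iso 0F 2F) (s≤s (s≤s z≤n))

  OrderIso-213⁺ : val w j < val w i → val w i < val w l → OrderIso w p213 (triple i j l)
  OrderIso-213⁺ j<i i<l = OrderIso-monotone w p213 (triple i j l) p213-IsPerm mono
    where
    mono : ∀ a b → lookup p213 a Fin.< lookup p213 b →
      lookup w (triple i j l a) Fin.< lookup w (triple i j l b)
    mono 0F 2F _ = i<l
    mono 1F 0F _ = j<i
    mono 1F 2F _ = <-trans j<i i<l
    mono 0F 0F (s≤s ())
    mono 0F 1F ()
    mono 1F 1F ()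
    mono 2F 0F (s≤s ())
    mono 2F 1F ()
    mono 2F 2F (s≤s (s≤s ()))

  OrderIso-132⁻ : OrderIso w p132 (triple i j l) → val w i < val w l × val w l < val w j
  OrderIso-132⁻ iso = proj₂ (iso 0F 2F) (s≤s z≤n) , proj₂ (iso 2F 1F) (s≤s (s≤s z≤n))

  OrderIso-132⁺ : val w i < val w l → val w l < val w j → OrderIso w p132 (triple i j l)
  OrderIso-132⁺ i<l l<j = OrderIso-monotone w p132 (triple i j l) p132-IsPerm mono
    where
    mono : ∀ a b → lookup p132 a Fin.< lookup p132 b →
      lookup w (triple i j l a) Fin.< lookup w (triple i j l b)
    mono 0F 1F _ = <-trans i<l l<j
    mono 0F 2F _ = i<l
    mono 2F 1F _ = l<j
    mono 0F 0F ()
    mono 1F 0F ()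
    mono 1F 1F (s≤s (s≤s ()))
    mono 1F 2F (s≤s ())
    mono 2F 0F ()
    mono 2F 2F (s≤s ())

Contains-213⇒Has213 : ∀ {n} (w : Vec (Fin n) n) → Contains w p213 → Has213 (values w)
Contains-213⇒Has213 w (i , j , l , i<j , j<l , iso) with j<i , i<l ← OrderIso-213⁻ w i j l iso =
  val w i , val w j , val w l , ⊆-values³ w i j l i<j j<l , j<i , i<l

Has213⇒Contains-213 : ∀ {n} (w : Vec (Fin n) n) → Has213 (values w) → Contains w p213
Has213⇒Contains-213 w (_ , _ , _ , xyz⊆ , y<x , x<z)
  with i , j , l , i<j , j<l , refl , refl , refl ← values-⊆³ w xyz⊆ =
  i , j , l , i<j , j<l , OrderIso-213⁺ w i j l y<x x<z

-- Mod-k-alternating 213-avoiding permutations as lists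

PermList : ℕ → List ℕ → Set
PermList n ℓ = Unique ℓ × All (_< n) ℓ × length ℓ ≡ n

glue : ℕ → List ℕ → List ℕ → List ℕ
glue v H L = v ∷ map (suc v +_) H ++ L

All-above : ∀ v H → All (v <_) (map (suc v +_) H)
All-above v H = All.map⁺ (All.universal (λ h → s≤s (m≤m+n v h)) H)

map-+-∸ : ∀ d (xs : List ℕ) → All (d ≤_) xs → map (d +_) (map (_∸ d) xs) ≡ xs
map-+-∸ d []       []           = refl
map-+-∸ d (x ∷ xs) (d≤x ∷ d≤xs) = cong₂ _∷_ (m+[n∸m]≡n d≤x) (map-+-∸ d xs d≤xs)

glue-PermList : ∀ {n v H L} → v ≤ n → PermList (n ∸ v) H → PermList v L → PermList (suc n) (glue v H L)
glue-PermList {n} {v} {H} {L} v≤n (uniqueH , H<n∸v , lenH) (uniqueL , L<v , lenL) = unique , bounded , len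
  where
  H′ = map (suc v +_) H
  unique : Unique (glue v H L)
  unique = All.++⁺ (All.map <⇒≢ (All-above v H)) (All.map (λ x<v → ≢-sym (<⇒≢ x<v)) L<v)
         ∷ Unique.++⁺ (Unique.map⁺ (+-cancelˡ-≡ (suc v) _ _) uniqueH) uniqueL
             (λ (x∈H′ , x∈L) → <-asym (All.lookup (All-above v H) x∈H′) (All.lookup L<v x∈L))
  bounded : All (_< suc n) (glue v H L)
  bounded = s≤s v≤n
          ∷ All.++⁺ (All.map⁺ (All.map (λ {h} h<n∸v → subst (suc v + h <_) (cong suc (m+[n∸m]≡n v≤n))
                                                          (+-monoʳ-< (suc v) h<n∸v)) H<n∸v))
                    (All.map (λ x<v → <-≤-trans x<v (m≤n⇒m≤1+n v≤n)) L<v)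
  len : length (glue v H L) ≡ suc n
  len = cong suc (begin
    length (H′ ++ L)       ≡⟨ length-++ H′ ⟩
    length H′ + length L   ≡⟨ cong₂ _+_ (trans (length-map (suc v +_) H) lenH) lenL ⟩
    n ∸ v + v              ≡⟨ m∸n+n≡m v≤n ⟩
    n                      ∎)
    where open ≡-Reasoning

glue-avoids : ∀ {v H L} → All (_< v) L → ¬ Has213 H → ¬ Has213 L → ¬ Has213 (glue v H L)
glue-avoids {v} {H} L<v avoidsH avoidsL has
  with Has213-++⁻ (All-above v H) L<v (Has213-∷⁻ (All-above v H) L<v has)
... | inj₁ hasH′ = avoidsH (Has213-map⁻ (suc v) H hasH′)
... | inj₂ hasL  = avoidsL hasL

glue-split : ∀ {n v rest} → PermList (suc n) (v ∷ rest) → ¬ Has213 (v ∷ rest) →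
  ∃[ H ] ∃[ L ] v ≤ n × PermList (n ∸ v) H × PermList v L × ¬ Has213 H × ¬ Has213 L
                × v ∷ rest ≡ glue v H L
glue-split {n} {v} {rest} (v∉rest ∷ uniqueRest , v<1+n ∷ rest<1+n , len) avoids =
  H , L , v≤n , (uniqueH , H<n∸v , proj₁ lengths-exact) , (uniqueL , L<v , proj₂ lengths-exact) ,
  avoidsH , avoidsL , cong (v ∷_) (trans (sym rest≡) (cong (_++ L) (sym H₀≡)))
  where
  v≤n = s≤s⁻¹ v<1+n
  H₀ = takeWhile (v <?_) rest
  L  = dropWhile (v <?_) rest
  H  = map (_∸ suc v) H₀
  rest≡ : H₀ ++ L ≡ rest
  rest≡ = takeWhile++dropWhile (v <?_) rest
  H₀≡ : map (suc v +_) H ≡ H₀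
  H₀≡ = map-+-∸ (suc v) H₀ (All.all-takeWhile (v <?_) rest)
  L<v : All (_< v) L
  L<v = dropWhile-above-below v (v <?_) rest v∉rest avoids
  uniqueH : Unique H
  uniqueH = Unique.map⁻ (subst Unique (sym H₀≡) (Unique-⊆ (takeWhile-⊆ (v <?_) rest) uniqueRest))
  uniqueL : Unique L
  uniqueL = Unique-⊆ (dropWhile-⊆ (v <?_) rest) uniqueRest
  H<n∸v : All (_< n ∸ v) H
  H<n∸v = All.map⁺ (All.zipWith (λ (v<h , h<1+n) → ∸-monoˡ-< h<1+n v<h)
                                (All.all-takeWhile (v <?_) rest , All-resp-⊆ (takeWhile-⊆ (v <?_) rest) rest<1+n))
  lengths : length H + length L ≡ n
  lengths = begin
    length H + length L   ≡⟨ cong (_+ length L) (length-map (_∸ suc v) H₀) ⟩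
    length H₀ + length L  ≡⟨ length-++ H₀ ⟨
    length (H₀ ++ L)      ≡⟨ cong length rest≡ ⟩
    length rest           ≡⟨ suc-injective len ⟩
    n                     ∎
    where open ≡-Reasoning
  lengths-exact : length H ≡ n ∸ v × length L ≡ v
  lengths-exact = +-split-≤ v≤n lengths (length-unique-bounded H uniqueH H<n∸v)
                                        (length-unique-bounded L uniqueL L<v)
  avoidsH : ¬ Has213 H
  avoidsH has =
    avoids (Has213-⊆ (v ∷ʳ takeWhile-⊆ (v <?_) rest) (subst Has213 H₀≡ (Has213-map⁺ (suc v) H has)))
  avoidsL : ¬ Has213 L
  avoidsL has = avoids (Has213-⊆ (v ∷ʳ dropWhile-⊆ (v <?_) rest) has)

glue-injective : ∀ {v H H′ L L′} → length H ≡ length H′ →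
  glue v H L ≡ glue v H′ L′ → H ≡ H′ × L ≡ L′
glue-injective {v} {H} {H′} {L} {L′} len eq
  with H+≡ , refl ← ++-injective {xs = map (suc v +_) H} {map (suc v +_) H′} {L} {L′}
                       (trans (length-map (suc v +_) H) (trans len (sym (length-map (suc v +_) H′))))
                       (∷-injectiveʳ eq) =
  map-injective (+-cancelˡ-≡ (suc v) _ _) H+≡ , refl

module Counting (k : ℕ) .{{_ : NonZero k}} where

  open Modular k

  -- AltFrom t ℓ: the entry of ℓ at index i is congruent to t + i.
  AltFrom : ℕ → List ℕ → Set
  AltFrom t []      = ⊤
  AltFrom t (x ∷ ℓ) = x ≈ t × AltFrom (suc t) ℓ

  altFrom? : ∀ t ℓ → Dec (AltFrom t ℓ)
  altFrom? t []      = yes tt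
  altFrom? t (x ∷ ℓ) = (x ≈? t) ×-dec altFrom? (suc t) ℓ

  AltFrom-resp : ∀ {t t′} ℓ → t ≈ t′ → AltFrom t ℓ → AltFrom t′ ℓ
  AltFrom-resp []      _    _            = tt
  AltFrom-resp (x ∷ ℓ) t≈t′ (x≈t , alt) = trans x≈t t≈t′ , AltFrom-resp ℓ (+-≈ {1} refl t≈t′) alt

  AltFrom-++⁺ : ∀ t A B → AltFrom t A → AltFrom (t + length A) B → AltFrom t (A ++ B)
  AltFrom-++⁺ t []      B altA altB = subst (λ s → AltFrom s B) (+-identityʳ t) altB
  AltFrom-++⁺ t (x ∷ A) B (x≈t , altA) altB =
    x≈t , AltFrom-++⁺ (suc t) A B altA (subst (λ s → AltFrom s B) (+-suc t (length A)) altB)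

  AltFrom-++⁻ : ∀ t A B → AltFrom t (A ++ B) → AltFrom t A × AltFrom (t + length A) B
  AltFrom-++⁻ t []      B alt = tt , subst (λ s → AltFrom s B) (sym (+-identityʳ t)) alt
  AltFrom-++⁻ t (x ∷ A) B (x≈t , alt) with altA , altB ← AltFrom-++⁻ (suc t) A B alt =
    (x≈t , altA) , subst (λ s → AltFrom s B) (sym (+-suc t (length A))) altB

  AltFrom-map⁺ : ∀ d t H → AltFrom t H → AltFrom (d + t) (map (d +_) H)
  AltFrom-map⁺ d t []      _           = tt
  AltFrom-map⁺ d t (x ∷ H) (x≈t , alt) =
    +-≈ {d} refl x≈t , subst (λ s → AltFrom s (map (d +_) H)) (+-suc d t) (AltFrom-map⁺ d (suc t) H alt)

  AltFrom-map⁻ : ∀ d t H → AltFrom (d + t) (map (d +_) H) → AltFrom t H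
  AltFrom-map⁻ d t []      _           = tt
  AltFrom-map⁻ d t (x ∷ H) (x≈t , alt) =
    +-cancelˡ-≈ d x≈t ,
    AltFrom-map⁻ d (suc t) H (subst (λ s → AltFrom s (map (d +_) H)) (sym (+-suc d t)) alt)

  AltFrom-values⁺ : ∀ {n m} t (w : Vec (Fin n) m) → (∀ i → val w i ≈ t + toℕ i) → AltFrom t (values w)
  AltFrom-values⁺ t []      _   = tt
  AltFrom-values⁺ t (x ∷ w) alt =
    trans (alt Fin.zero) (cong (_% k) (+-identityʳ t)) ,
    AltFrom-values⁺ (suc t) w λ i → trans (alt (Fin.suc i)) (cong (_% k) (+-suc t (toℕ i)))

  AltFrom-values⁻ : ∀ {n m} t (w : Vec (Fin n) m) → AltFrom t (values w) → ∀ i → val w i ≈ t + toℕ i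
  AltFrom-values⁻ t (x ∷ w) (x≈t , _) Fin.zero    = trans x≈t (cong (_% k) (sym (+-identityʳ t)))
  AltFrom-values⁻ t (x ∷ w) (_ , alt) (Fin.suc i) =
    trans (AltFrom-values⁻ (suc t) w alt i) (cong (_% k) (sym (+-suc t (toℕ i))))

  Avoider : ℕ → ℕ → List ℕ → Set
  Avoider n t ℓ = PermList n ℓ × AltFrom t ℓ × ¬ Has213 ℓ

  good? : ∀ n t (w : Vec (Fin n) n) → Dec (IsPerm w × AltFrom t (values w) × ¬ Contains w p213)
  good? n t w = isPerm? w ×-dec (altFrom? t (values w) ×-dec ¬? (contains? w p213))

  opaque
    avoiders : ℕ → ℕ → List (List ℕ)
    avoiders n t = map values (filter (good? n t) (allWords n n))

    length-avoiders : ∀ n t → length (avoiders n t) ≡ length (filter (good? n t) (allWords n n))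
    length-avoiders n t = length-map values (filter (good? n t) (allWords n n))

    avoiders-zero : ∀ t → avoiders 0 t ≡ [] ∷ []
    avoiders-zero t = refl

    avoiders-Unique : ∀ n t → Unique (avoiders n t)
    avoiders-Unique n t = Unique.map⁺ (values-injective _ _) (Unique.filter⁺ (good? n t) (allWords-Unique n n))

    ∈-avoiders⁻ : ∀ {n t ℓ} → ℓ ∈ avoiders n t → Avoider n t ℓ
    ∈-avoiders⁻ {n} {t} ℓ∈
      with w , w∈ , refl ← ∈-map⁻ values ℓ∈
      with _ , (perm , alt , avoids) ← ∈-filter⁻ (good? n t) {xs = allWords n n} w∈ =
      (injective⇒Unique-values w perm , values-bounded w , length-values w) ,
      alt , avoids ∘ Has213⇒Contains-213 w

    ∈-avoiders⁺ : ∀ {n t ℓ} → Avoider n t ℓ → ℓ ∈ avoiders n t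
    ∈-avoiders⁺ {n} {t} {ℓ} ((unique , bounded , len) , alt , avoids)
      with w , refl ← fromValues n ℓ len bounded =
      ∈-map⁺ values (∈-filter⁺ (good? n t) (∈-allWords n n w)
        (Unique-values⇒injective w unique , alt , avoids ∘ Contains-213⇒Has213 w))

  length-∈-avoiders : ∀ {n t ℓ} → ℓ ∈ avoiders n t → length ℓ ≡ n
  length-∈-avoiders ℓ∈ with (_ , _ , len) , _ ← ∈-avoiders⁻ ℓ∈ = len

  count : ℕ → ℕ → ℕ
  count n t = length (avoiders n t)

  count-zero : ∀ t → count 0 t ≡ 1
  count-zero t = cong length (avoiders-zero t)

  count-resp : ∀ n {t t′} → t ≈ t′ → count n t ≡ count n t′
  count-resp n {t} {t′} t≈t′ = length-unique-≡ (avoiders-Unique n t) (avoiders-Unique n t′)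
    (∈-avoiders⁺ ∘ Avoider-resp t≈t′ ∘ ∈-avoiders⁻)
    (∈-avoiders⁺ ∘ Avoider-resp (sym t≈t′) ∘ ∈-avoiders⁻)
    where
    Avoider-resp : ∀ {s s′ ℓ} → s ≈ s′ → Avoider n s ℓ → Avoider n s′ ℓ
    Avoider-resp {ℓ = ℓ} s≈s′ (perm , alt , avoids) = perm , AltFrom-resp ℓ s≈s′ alt , avoids

  mp213≡count : ∀ n → mp p213 n k ≡ count n 0
  mp213≡count n = trans
    (cong length (filter-≐ _ (good? n 0) (to , from) (allWords n n)))
    (sym (length-avoiders n 0))
    where
    to : ∀ {w} → IsPerm w × ModAlt k w × ¬ Contains w p213 →
      IsPerm w × AltFrom 0 (values w) × ¬ Contains w p213
    to {w} (perm , alt , avoids) = perm , AltFrom-values⁺ 0 w alt , avoids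
    from : ∀ {w} → IsPerm w × AltFrom 0 (values w) × ¬ Contains w p213 →
      IsPerm w × ModAlt k w × ¬ Contains w p213
    from {w} (perm , alt , avoids) = perm , AltFrom-values⁻ 0 w alt , avoids

  AltFrom-glue⁺ : ∀ {t v} H L → v ≈ t → AltFrom 0 H → AltFrom (suc t + length H) L →
    AltFrom t (glue v H L)
  AltFrom-glue⁺ {t} {v} H L v≈t altH altL = v≈t , AltFrom-++⁺ (suc t) H′ L
    (AltFrom-resp H′ (suc-+0-≈ v≈t) (AltFrom-map⁺ (suc v) 0 H altH))
    (subst (λ s → AltFrom (suc t + s) L) (sym (length-map (suc v +_) H)) altL)
    where H′ = map (suc v +_) H

  AltFrom-glue⁻ : ∀ {t v} H L → AltFrom t (glue v H L) →
    v ≈ t × AltFrom 0 H × AltFrom (suc t + length H) L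
  AltFrom-glue⁻ {t} {v} H L (v≈t , alt) with altH′ , altL ← AltFrom-++⁻ (suc t) (map (suc v +_) H) L alt =
    v≈t ,
    AltFrom-map⁻ (suc v) 0 H (AltFrom-resp _ (sym (suc-+0-≈ v≈t)) altH′) ,
    subst (λ s → AltFrom (suc t + s) L) (length-map (suc v +_) H) altL

  glue-Avoider : ∀ {n t v H L} → v ≤ n → v ≈ t →
    Avoider (n ∸ v) 0 H → Avoider v (suc t + (n ∸ v)) L → Avoider (suc n) t (glue v H L)
  glue-Avoider {H = H} {L} v≤n v≈t
    (permH@(_ , _ , lenH) , altH , avoidsH) (permL@(_ , L<v , _) , altL , avoidsL) =
    glue-PermList v≤n permH permL ,
    AltFrom-glue⁺ H L v≈t altH (subst (λ s → AltFrom (suc _ + s) L) (sym lenH) altL) ,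
    glue-avoids L<v avoidsH avoidsL

  Avoider-split : ∀ {n t ℓ} → Avoider (suc n) t ℓ →
    ∃[ v ] ∃[ H ] ∃[ L ] v ≤ n × v ≈ t × Avoider (n ∸ v) 0 H × Avoider v (suc t + (n ∸ v)) L
                       × ℓ ≡ glue v H L
  Avoider-split {n} {t} {v ∷ rest} (perm , alt , avoids)
    with H , L , v≤n , permH@(_ , _ , lenH) , permL , avoidsH , avoidsL , refl ← glue-split perm avoids
    with v≈t , altH , altL ← AltFrom-glue⁻ H L alt =
    v , H , L , v≤n , v≈t , (permH , altH , avoidsH) ,
    (permL , subst (λ s → AltFrom (suc t + s) L) lenH altL , avoidsL) , refl

  heads : ℕ → ℕ → List ℕ
  heads n t = filter (_≈? t) (upTo (suc n))

  gluedFrom : ℕ → ℕ → ℕ → List (List ℕ)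
  gluedFrom n t v = concatMap (λ H → map (glue v H) (avoiders v (suc t + (n ∸ v)))) (avoiders (n ∸ v) 0)

  glued : ℕ → ℕ → List (List ℕ)
  glued n t = concatMap (gluedFrom n t) (heads n t)

  ∈-glued⁻ : ∀ {n t ℓ} → ℓ ∈ glued n t → Avoider (suc n) t ℓ
  ∈-glued⁻ {n} {t} ℓ∈
    with v , v∈ , ℓ∈v ← ∈-concatMap⁻′ (gluedFrom n t) (heads n t) ℓ∈
    with H , H∈ , ℓ∈vH ← ∈-concatMap⁻′ _ (avoiders (n ∸ v) 0) ℓ∈v
    with L , L∈ , refl ← ∈-map⁻ (glue v H) ℓ∈vH
    with v<1+n , v≈t ← ∈-filter⁻ (_≈? t) {xs = upTo (suc n)} v∈ =
    glue-Avoider {n} {t} {v} {H} {L} (s≤s⁻¹ (∈-upTo⁻ v<1+n)) v≈t (∈-avoiders⁻ H∈) (∈-avoiders⁻ L∈)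

  ∈-glued⁺ : ∀ {n t ℓ} → Avoider (suc n) t ℓ → ℓ ∈ glued n t
  ∈-glued⁺ {n} {t} avoider with v , H , L , v≤n , v≈t , avH , avL , refl ← Avoider-split avoider =
    ∈-concatMap⁺′ (gluedFrom n t) (∈-filter⁺ (_≈? t) (∈-upTo⁺ (s≤s v≤n)) v≈t)
      (∈-concatMap⁺′ _ (∈-avoiders⁺ avH) (∈-map⁺ (glue v H) (∈-avoiders⁺ avL)))

  glued-Unique : ∀ n t → Unique (glued n t)
  glued-Unique n t = Unique-concatMap⁺ (gluedFrom n t)
    (Unique.filter⁺ (_≈? t) (Unique.upTo⁺ (suc n))) (λ _ → gluedFrom-Unique) same-head
    where
    gluedFrom-Unique : ∀ {v} → Unique (gluedFrom n t v)
    gluedFrom-Unique {v} = Unique-concatMap⁺ _ (avoiders-Unique (n ∸ v) 0)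
      (λ _ → Unique.map⁺ (λ eq → proj₂ (glue-injective refl eq)) (avoiders-Unique v _))
      λ H∈ H′∈ ℓ∈ ℓ∈′ → same-H H∈ H′∈ (∈-map⁻ _ ℓ∈) (∈-map⁻ _ ℓ∈′)
      where
      same-H : ∀ {H H′ ℓ} → H ∈ avoiders (n ∸ v) 0 → H′ ∈ avoiders (n ∸ v) 0 →
        ∃[ L ] L ∈ avoiders v (suc t + (n ∸ v)) × ℓ ≡ glue v H L →
        ∃[ L ] L ∈ avoiders v (suc t + (n ∸ v)) × ℓ ≡ glue v H′ L → H ≡ H′
      same-H H∈ H′∈ (_ , _ , refl) (_ , _ , eq) =
        proj₁ (glue-injective (trans (length-∈-avoiders H∈) (sym (length-∈-avoiders H′∈))) eq)
    head-of : ∀ {v ℓ} → ℓ ∈ gluedFrom n t v → ∃[ rest ] ℓ ≡ v ∷ rest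
    head-of {v} ℓ∈
      with H , _ , ℓ∈vH ← ∈-concatMap⁻′ _ (avoiders (n ∸ v) 0) ℓ∈
      with L , _ , refl ← ∈-map⁻ (glue v H) ℓ∈vH = _ , refl
    same-head : ∀ {v v′ ℓ} → v ∈ heads n t → v′ ∈ heads n t →
      ℓ ∈ gluedFrom n t v → ℓ ∈ gluedFrom n t v′ → v ≡ v′
    same-head _ _ ℓ∈ ℓ∈′ with _ , refl ← head-of ℓ∈ | _ , eq ← head-of ℓ∈′ = ∷-injectiveˡ eq

  count-suc : ∀ n t →
    count (suc n) t ≡ ∑[ v < suc n ] select (v ≈? t) (count (n ∸ v) 0 * count v (suc t + (n ∸ v)))
  count-suc n t = begin
    count (suc n) t
      ≡⟨ length-unique-≡ (avoiders-Unique (suc n) t) (glued-Unique n t)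
                         (∈-glued⁺ ∘ ∈-avoiders⁻) (∈-avoiders⁺ ∘ ∈-glued⁻) ⟩
    length (glued n t)
      ≡⟨ length-concatMap (gluedFrom n t) (heads n t) ⟩
    sum (map (length ∘ gluedFrom n t) (heads n t))
      ≡⟨ cong sum (map-cong (λ v → length-concatMap-map (glue v) (avoiders (n ∸ v) 0) _) (heads n t)) ⟩
    sum (map (λ v → count (n ∸ v) 0 * count v (suc t + (n ∸ v))) (heads n t))
      ≡⟨ sum-filter-upTo (_≈? t) _ (suc n) ⟩
    ∑[ v < suc n ] select (v ≈? t) (count (n ∸ v) 0 * count v (suc t + (n ∸ v))) ∎
    where open ≡-Reasoning

  count₀ : ℕ → ℕ
  count₀ n = count n 0

  glued-term : ∀ {m v t s} → (v ≈ t → count v s ≡ count₀ v) →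
    select (v ≈? t) (count₀ (m ∸ v) * count v s) ≡ restrict 0 t count₀ v * count₀ (m ∸ v)
  glued-term {m} {v} {t} {s} count≡ = begin
    select (v ≈? t) (count₀ (m ∸ v) * count v s)
      ≡⟨ select-congʳ (v ≈? t) (λ v≈t → trans (cong (count₀ (m ∸ v) *_) (count≡ v≈t))
                                               (*-comm (count₀ (m ∸ v)) (count₀ v))) ⟩
    select (v ≈? t) (count₀ v * count₀ (m ∸ v))
      ≡⟨ select-*ˡ (v ≈? t) (count₀ v) (count₀ (m ∸ v)) ⟨
    restrict 0 t count₀ v * count₀ (m ∸ v) ∎
    where open ≡-Reasoning

  count-suc-restrict : ∀ m t → suc m ≈ 0 → count (suc m) t ≡ (restrict 0 t count₀ ⋆ count₀) m
  count-suc-restrict m t 1+m≈0 = trans (count-suc m t) (∑-cong (suc m) λ v v<1+m →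
    glued-term λ v≈t → count-resp v (complement-class v≈t (s≤s⁻¹ v<1+m) 1+m≈0))

  count-multiple : ∀ v t → v ≈ 0 → (∀ u → u < v → SievedRecurrence count₀ u) → count v t ≡ count₀ v
  count-multiple zero    t _     _   = trans (count-zero t) (sym (count-zero 0))
  count-multiple (suc m) t 1+m≈0 rec = begin
    count (suc m) t                      ≡⟨ count-suc-restrict m t 1+m≈0 ⟩
    (restrict 0 t count₀ ⋆ count₀) m     ≡⟨ restrict-⋆-invariant count₀ m 1+m≈0
                                               (λ u u<m → rec u (m<n⇒m<1+n u<m)) t ⟩
    (restrict 0 0 count₀ ⋆ count₀) m     ≡⟨ count-suc-restrict m 0 1+m≈0 ⟨
    count₀ (suc m)                       ∎
    where open ≡-Reasoning

  count₀-sievedRecurrence : ∀ n → SievedRecurrence count₀ n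
  count₀-sievedRecurrence = <-rec (SievedRecurrence count₀) λ n rec →
    trans (count-suc n 0) (∑-cong (suc n) λ v v<1+n →
      glued-term λ v≈0 → count-multiple v _ v≈0 λ u u<v → rec (<-≤-trans u<v (s≤s⁻¹ v<1+n)))

-- Reverse-complement exchanges 213 and 132

rc : ∀ {n} → Vec (Fin n) n → Vec (Fin n) n
rc w = tabulate (λ i → opposite (lookup w (opposite i)))

lookup-rc : ∀ {n} (w : Vec (Fin n) n) i → lookup (rc w) i ≡ opposite (lookup w (opposite i))
lookup-rc w i = Vec.lookup∘tabulate _ i

opposite-injective : ∀ {n} {i j : Fin n} → opposite i ≡ opposite j → i ≡ j
opposite-injective {i = i} {j} eq =
  trans (sym (Fin.opposite-involutive i)) (trans (cong opposite eq) (Fin.opposite-involutive j))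

rc-involutive : ∀ {n} (w : Vec (Fin n) n) → rc (rc w) ≡ w
rc-involutive w = trans (Vec.tabulate-cong λ i → begin
    opposite (lookup (rc w) (opposite i))                ≡⟨ cong opposite (lookup-rc w (opposite i)) ⟩
    opposite (opposite (lookup w (opposite (opposite i)))) ≡⟨ Fin.opposite-involutive _ ⟩
    lookup w (opposite (opposite i))                     ≡⟨ cong (lookup w) (Fin.opposite-involutive i) ⟩
    lookup w i                                           ∎)
  (Vec.tabulate∘lookup w)
  where open ≡-Reasoning

rc-injective : ∀ {n} {w w′ : Vec (Fin n) n} → rc w ≡ rc w′ → w ≡ w′
rc-injective {w = w} {w′} eq = trans (sym (rc-involutive w)) (trans (cong rc eq) (rc-involutive w′))

rc-IsPerm : ∀ {n} (w : Vec (Fin n) n) → IsPerm w → IsPerm (rc w)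
rc-IsPerm w perm i j eq =
  opposite-injective (perm _ _ (opposite-injective (trans (sym (lookup-rc w i)) (trans eq (lookup-rc w j)))))

val-rc : ∀ {n} (w : Vec (Fin n) n) i → val (rc w) i ≡ n ∸ suc (val w (opposite i))
val-rc w i = trans (cong toℕ (lookup-rc w i)) (Fin.opposite-prop _)

opposite-< : ∀ {n} {i j : Fin n} → i Fin.< j → opposite j Fin.< opposite i
opposite-< {n} {i} {j} i<j = subst₂ _<_ (sym (Fin.opposite-prop j)) (sym (Fin.opposite-prop i))
  (∸-monoʳ-< (s≤s i<j) (Fin.toℕ<n j))

val-rc-< : ∀ {n} (w : Vec (Fin n) n) i j → val (rc w) i < val (rc w) j → val w (opposite j) < val w (opposite i)
val-rc-< {n} w i j lt with val w (opposite j) <? val w (opposite i)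
... | yes gt = gt
... | no  ≮  = ⊥-elim (<⇒≱ (subst₂ _<_ (val-rc w i) (val-rc w j) lt) (∸-monoʳ-≤ n (s≤s (≮⇒≥ ≮))))

rc-132⇒213 : ∀ {n} (w : Vec (Fin n) n) → Contains (rc w) p132 → Contains w p213
rc-132⇒213 w (i , j , l , i<j , j<l , iso) with i<l , l<j ← OrderIso-132⁻ (rc w) i j l iso =
  opposite l , opposite j , opposite i , opposite-< j<l , opposite-< i<j ,
  OrderIso-213⁺ w (opposite l) (opposite j) (opposite i) (val-rc-< w l j l<j) (val-rc-< w i l i<l)

rc-213⇒132 : ∀ {n} (w : Vec (Fin n) n) → Contains (rc w) p213 → Contains w p132
rc-213⇒132 w (i , j , l , i<j , j<l , iso) with j<i , i<l ← OrderIso-213⁻ (rc w) i j l iso =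
  opposite l , opposite j , opposite i , opposite-< j<l , opposite-< i<j ,
  OrderIso-132⁺ w (opposite l) (opposite j) (opposite i) (val-rc-< w i l i<l) (val-rc-< w j i j<i)

module _ (k : ℕ) .{{_ : NonZero k}} where

  open Modular k

  ∸-≈ : ∀ {n a b} → a ≈ b → a < n → b < n → n ∸ suc a ≈ n ∸ suc b
  ∸-≈ {n} {a} {b} a≈b a<n b<n = +-cancelˡ-≈ (suc a) (begin
    (suc a + (n ∸ suc a)) % k ≡⟨ cong (_% k) (trans (m+[n∸m]≡n a<n) (sym (m+[n∸m]≡n b<n))) ⟩
    (suc b + (n ∸ suc b)) % k ≡⟨ +-≈ {suc b} {suc a} (+-≈ {1} refl (sym a≈b)) refl ⟩
    (suc a + (n ∸ suc b)) % k ∎)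
    where open ≡-Reasoning

  rc-ModAlt : ∀ {n} (w : Vec (Fin n) n) → ModAlt k w → ModAlt k (rc w)
  rc-ModAlt {n} w alt i = begin
    val (rc w) i % k                            ≡⟨ cong (_% k) (val-rc w i) ⟩
    (n ∸ suc (val w (opposite i))) % k          ≡⟨ ∸-≈ (alt (opposite i)) (Fin.toℕ<n _) (Fin.toℕ<n _) ⟩
    (n ∸ suc (toℕ (opposite i))) % k            ≡⟨ cong (_% k) (Fin.opposite-prop (opposite i)) ⟨
    toℕ (opposite (opposite i)) % k             ≡⟨ cong (λ j → toℕ j % k) (Fin.opposite-involutive i) ⟩
    toℕ i % k                                   ∎
    where open ≡-Reasoning

  mp213≡mp132 : ∀ n → mp p213 n k ≡ mp p132 n k
  mp213≡mp132 n = trans (sym (length-map rc (filter avoids213? words)))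
    (length-unique-≡ (Unique.map⁺ rc-injective (Unique.filter⁺ avoids213? (allWords-Unique n n)))
                     (Unique.filter⁺ avoids132? (allWords-Unique n n)) to from)
    where
    words = allWords n n
    avoids213? = λ (w : Vec (Fin n) n) → isPerm? w ×-dec (modAlt? k w ×-dec ¬? (contains? w p213))
    avoids132? = λ (w : Vec (Fin n) n) → isPerm? w ×-dec (modAlt? k w ×-dec ¬? (contains? w p132))
    to : ∀ {w} → w ∈ map rc (filter avoids213? words) → w ∈ filter avoids132? words
    to w∈
      with u , u∈ , refl ← ∈-map⁻ rc w∈
      with _ , (perm , alt , avoids) ← ∈-filter⁻ avoids213? {xs = words} u∈ =
      ∈-filter⁺ avoids132? (∈-allWords n n (rc u))
        (rc-IsPerm u perm , rc-ModAlt u alt , avoids ∘ rc-132⇒213 u)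
    from : ∀ {w} → w ∈ filter avoids132? words → w ∈ map rc (filter avoids213? words)
    from {w} w∈ with _ , (perm , alt , avoids) ← ∈-filter⁻ avoids132? {xs = words} w∈ =
      subst (_∈ map rc (filter avoids213? words)) (rc-involutive w)
        (∈-map⁺ rc (∈-filter⁺ avoids213? (∈-allWords n n (rc w))
          (rc-IsPerm w perm , rc-ModAlt w alt , avoids ∘ rc-213⇒132 w)))

module _ (k : ℕ) .{{_ : NonZero k}} where

  open Modular k
  open Counting k

  a≡count₀ : ∀ j → a k j ≡ count₀ j
  a≡count₀ zero    = sym (count-zero 0)
  a≡count₀ (suc j) = mp213≡count (suc j)

  a-convolution : ∀ n → a k (suc n) ≡ convSum k n
  a-convolution n = begin
    a k (suc n)                                           ≡⟨ a≡count₀ (suc n) ⟩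
    count₀ (suc n)                                        ≡⟨ count₀-sievedRecurrence n ⟩
    (restrict 0 0 count₀ ⋆ count₀) n                      ≡⟨ ∑-cong (suc n) (λ j _ → term j) ⟩
    ∑[ j < suc n ] select (k ∣? j) (a k j * a k (n ∸ j))  ≡⟨ sum-filter-upTo (k ∣?_) _ (suc n) ⟨
    convSum k n                                           ∎
    where
    open ≡-Reasoning
    term : ∀ j → restrict 0 0 count₀ j * count₀ (n ∸ j) ≡ select (k ∣? j) (a k j * a k (n ∸ j))
    term j = begin
      restrict 0 0 count₀ j * count₀ (n ∸ j)        ≡⟨ select-*ˡ (j ≈? 0) (count₀ j) _ ⟩
      select (j ≈? 0) (count₀ j * count₀ (n ∸ j))   ≡⟨ select-cong (j ≈? 0) (k ∣? j) ≈0⇒∣ ∣⇒≈0 ⟩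
      select (k ∣? j) (count₀ j * count₀ (n ∸ j))
        ≡⟨ cong (select (k ∣? j)) (cong₂ _*_ (a≡count₀ j) (a≡count₀ (n ∸ j))) ⟨
      select (k ∣? j) (a k j * a k (n ∸ j))         ∎

mainTheorem5 : (k : ℕ) .{{_ : NonZero k}} →
    ((n : ℕ) → mp p213 (suc n) k ≡ mp p132 (suc n) k)
    × ((n : ℕ) → a k (suc n) ≡ convSum k n)
mainTheorem5 k = (λ n → mp213≡mp132 k (suc n)) , a-convolution k
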